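{- Let $G$ be a graph of order $n\geq 1$. Then $\operatorname{zir}(G)=1$ if and only if $G\cong P_n$ or $G\cong K_{1,n-1}$.
   Context: $P_n$ is the path and $K_{1,n-1}$ the star on $n$ vertices. A fort is a nonempty $F\subseteq V(G)$ such that every $v\notin F$ has $|F\cap N(v)|\neq 1$. For $S\subseteq V(G)$, $x\in S$, a private fort of $x$ relative to $S$ is a fort $F$ with $S\cap F=\{x\}$; $S$ is a ZIr-set if every element has a private fort. $\operatorname{zir}(G)$ is the minimum cardinality of an inclusion-maximal ZIr-set of $G$. -}

module Defs where

open import Data.Nat using (ℕ; zero; suc; _≤_; _∸_; _+_)
open import Data.Nat.Properties using (+-comm; n∸n≡0)
open import Relation.Binary.PropositionalEquality using (refl; cong)
open import Data.Bool using (Bool; true; false; not; _xor_)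
open import Data.Fin as Fin using (Fin; toℕ)
open import Data.Fin.Subset using (Subset; _∈_; _∉_; _⊆_; _∩_; ⁅_⁆; ∣_∣; Nonempty)
open import Data.Vec using (tabulate)
open import Data.Product using (Σ; _×_; ∃)
open import Relation.Binary.PropositionalEquality using (_≡_; _≢_)
open import Function.Bundles using (_↔_; Inverse)

record Graph (n : ℕ) : Set where
  field
    adj   : Fin n → Fin n → Bool
    sym   : ∀ u v → adj u v ≡ adj v u
    irref : ∀ v → adj v v ≡ false
open Graph public

N : ∀ {n} → Graph n → Fin n → Subset n
N G v = tabulate (λ u → adj G v u)

IsFort : ∀ {n} → Graph n → Subset n → Set
IsFort G F = Nonempty F × (∀ v → v ∉ F → ∣ F ∩ N G v ∣ ≢ 1)

IsPrivateFort : ∀ {n} → Graph n → Subset n → Fin n → Subset n → Set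
IsPrivateFort G S x F = IsFort G F × (S ∩ F ≡ ⁅ x ⁆)

IsZIrSet : ∀ {n} → Graph n → Subset n → Set
IsZIrSet G S = ∀ x → x ∈ S → ∃ λ F → IsPrivateFort G S x F

IsMaximalZIrSet : ∀ {n} → Graph n → Subset n → Set
IsMaximalZIrSet G S = IsZIrSet G S × (∀ T → S ⊆ T → IsZIrSet G T → T ⊆ S)

ZirEq : ∀ {n} → Graph n → ℕ → Set
ZirEq G k = (∃ λ S → IsMaximalZIrSet G S × ∣ S ∣ ≡ k)
          × (∀ S → IsMaximalZIrSet G S → k ≤ ∣ S ∣)

_≅_ : ∀ {n} → Graph n → Graph n → Set
_≅_ {n} G H = Σ (Fin n ↔ Fin n) λ σ →
  ∀ u v → adj G u v ≡ adj H (Inverse.to σ u) (Inverse.to σ v)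

isOne : ℕ → Bool
isOne (suc zero) = true
isOne _ = false

pathAdj : ∀ {n} → Fin n → Fin n → Bool
pathAdj i j = isOne ((toℕ i ∸ toℕ j) + (toℕ j ∸ toℕ i))

pathAdj-sym : ∀ {n} (i j : Fin n) → pathAdj i j ≡ pathAdj j i
pathAdj-sym i j = cong isOne (+-comm (toℕ i ∸ toℕ j) (toℕ j ∸ toℕ i))

pathAdj-irref : ∀ {n} (i : Fin n) → pathAdj i i ≡ false
pathAdj-irref i rewrite n∸n≡0 (toℕ i) = refl

P : (n : ℕ) → Graph n
P n = record { adj = pathAdj ; sym = pathAdj-sym ; irref = pathAdj-irref }

isZero : ∀ {n} → Fin n → Bool
isZero Fin.zero = true
isZero (Fin.suc _) = false

starAdj : ∀ {n} → Fin n → Fin n → Bool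
starAdj i j = isZero i xor isZero j

starAdj-sym : ∀ {n} (i j : Fin n) → starAdj i j ≡ starAdj j i
starAdj-sym Fin.zero Fin.zero = refl
starAdj-sym Fin.zero (Fin.suc _) = refl
starAdj-sym (Fin.suc _) Fin.zero = refl
starAdj-sym (Fin.suc _) (Fin.suc _) = refl

starAdj-irref : ∀ {n} (i : Fin n) → starAdj i i ≡ false
starAdj-irref Fin.zero = refl
starAdj-irref (Fin.suc _) = refl

Star : (n : ℕ) → Graph n
Star n = record { adj = starAdj ; sym = starAdj-sym ; irref = starAdj-irref }

{-# OPTIONS --safe #-}
module Submission where

-- V(G) is a fort, so every singleton is a ZIr-set; ZIr-sets are closed under subsets, and {x, y}
-- is one exactly when some fort contains x but not y and another contains y but not x. Hence
-- zir(G) = 1 exactly when some vertex x is inseparable in this sense from every other vertex. In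
-- P_n every fort contains the end 0, and in K_{1,n-1} every fort containing the centre 0 is
-- everything, so 0 is inseparable; this transfers along isomorphisms. Conversely, let x be
-- inseparable.
-- If deg x ≠ 1, then V - v is a fort for every vertex v with deg v ≠ 1, so every v ≠ x is a leaf;
-- a leaf not attached to x would form with its neighbour a K₂ component, which together with its
-- complement separates it from x. So G is a star centred at x.
-- If deg x = 1, grow an induced path from x on which only the growing end has neighbours off the
-- path. If the end has no such exits, the path is a union of components, which together with its
-- complement separates x from anything off the path, so the path spans G. If it has two or more,
-- the complement of the path is a fort separating an exit w from x, while x is separated from w by
-- V - w or, when w is a leaf, by V - {w, end}. So there is exactly one exit and the path grows.

open import Data.Bool using (Bool; true)
open import Data.Bool.Properties using (¬-not)
open import Data.Empty using (⊥-elim)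
open import Data.Fin as Fin using (Fin; toℕ; _≟_; inject₁)
open import Data.Fin.Permutation using (transpose; ↔⇒≡)
open import Data.Fin.Properties using (toℕ-injective; toℕ-inject₁; any?; injective⇒≤)
open import Data.Fin.Subset
open import Data.Fin.Subset.Properties
open import Data.Nat using (ℕ; zero; suc; _≤_; z≤n; s≤s; _∸_; _+_)
import Data.Nat as ℕ
import Data.Nat.Properties as ℕ
open import Data.Product using (_×_; ∃; _,_; proj₁; proj₂; uncurry)
open import Data.Sum using (_⊎_; inj₁; inj₂)
import Data.Sum as Sum
open import Data.Vec using ([]; _∷_; lookup; tabulate)
open import Data.Vec.Properties using (lookup∘tabulate; []=⇒lookup; lookup⇒[]=)
import Data.Vec.Functional as Vector
open import Function.Base using (_∘_; case_of_)
open import Function.Bundles using (_⇔_; mk⇔; Equivalence; Inverse; _↔_; mk↔ₛ′)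
open import Function.Construct.Symmetry using (↔-sym)
open import Function.Definitions using (Injective)
open import Relation.Binary.PropositionalEquality
open import Relation.Nullary using (¬_; ¬?; yes; no; does; contradiction; _×-dec_)
open import Relation.Nullary.Decidable using (decidable-stable; dec-true)

open import Defs renaming (sym to adj-sym)

private variable
  n : ℕ
  p : Subset n

∣p∣≡0⇒p≡⊥ : ∣ p ∣ ≡ 0 → p ≡ ⊥
∣p∣≡0⇒p≡⊥ {p = []} _ = refl
∣p∣≡0⇒p≡⊥ {p = outside ∷ p} ∣p∣≡0 = cong (outside ∷_) (∣p∣≡0⇒p≡⊥ ∣p∣≡0)

∣p∣≡1⇒p≡⁅x⁆ : ∣ p ∣ ≡ 1 → ∃ λ x → p ≡ ⁅ x ⁆
∣p∣≡1⇒p≡⁅x⁆ {p = inside ∷ p} ∣p∣≡1 = Fin.zero , cong (inside ∷_) (∣p∣≡0⇒p≡⊥ (ℕ.suc-injective ∣p∣≡1))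
∣p∣≡1⇒p≡⁅x⁆ {p = outside ∷ p} ∣p∣≡1 with x , p≡⁅x⁆ ← ∣p∣≡1⇒p≡⁅x⁆ ∣p∣≡1 = Fin.suc x , cong (outside ∷_) p≡⁅x⁆

p≡⁅x⁆⇔unique : ∀ {p : Subset n} {x} → p ≡ ⁅ x ⁆ ⇔ (x ∈ p × ∀ {y} → y ∈ p → y ≡ x)
p≡⁅x⁆⇔unique {p = p} {x} = mk⇔
  (λ { refl → x∈⁅x⁆ x , x∈⁅y⁆⇒x≡y x })
  (λ (x∈p , unique) → ⊆-antisym
    (λ y∈p → subst (_∈ ⁅ x ⁆) (sym (unique y∈p)) (x∈⁅x⁆ x))
    (λ y∈⁅x⁆ → subst (_∈ p) (sym (x∈⁅y⁆⇒x≡y x y∈⁅x⁆)) x∈p))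

∣p∣≡1⇔unique : ∣ p ∣ ≡ 1 ⇔ ∃ λ x → x ∈ p × ∀ {y} → y ∈ p → y ≡ x
∣p∣≡1⇔unique = mk⇔
  (λ ∣p∣≡1 → let x , p≡⁅x⁆ = ∣p∣≡1⇒p≡⁅x⁆ ∣p∣≡1 in x , Equivalence.to p≡⁅x⁆⇔unique p≡⁅x⁆)
  (λ (x , unique) → trans (cong ∣_∣ (Equivalence.from p≡⁅x⁆⇔unique unique)) (∣⁅x⁆∣≡1 x))

∣p∣≢1⇒another : ∀ {p : Subset n} {x} → ∣ p ∣ ≢ 1 → x ∈ p → ∃ λ y → y ∈ p × y ≢ x
∣p∣≢1⇒another {p = p} {x} ∣p∣≢1 x∈p with any? (λ y → y ∈? p ×-dec ¬? (y ≟ x))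
... | yes another = another
... | no none = ⊥-elim (∣p∣≢1 (Equivalence.from ∣p∣≡1⇔unique
        (x , x∈p , λ {y} y∈p → decidable-stable (y ≟ x) λ y≢x → none (y , y∈p , y≢x))))

x∈∁⁅y⁆∪⁅z⁆ : ∀ {x y z : Fin n} → x ≢ y → x ≢ z → x ∈ ∁ (⁅ y ⁆ ∪ ⁅ z ⁆)
x∈∁⁅y⁆∪⁅z⁆ {y = y} {z} x≢y x≢z = x∉p⇒x∈∁p λ x∈ → case x∈p∪q⁻ ⁅ y ⁆ ⁅ z ⁆ x∈ of λ where
  (inj₁ x∈⁅y⁆) → x≢y (x∈⁅y⁆⇒x≡y y x∈⁅y⁆)
  (inj₂ x∈⁅z⁆) → x≢z (x∈⁅y⁆⇒x≡y z x∈⁅z⁆)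

x∉∁⁅y⁆∪⁅z⁆ : ∀ {x y z : Fin n} → x ∉ ∁ (⁅ y ⁆ ∪ ⁅ z ⁆) → x ≡ y ⊎ x ≡ z
x∉∁⁅y⁆∪⁅z⁆ {y = y} {z} x∉ with x∈p∪q⁻ ⁅ y ⁆ ⁅ z ⁆ (x∉∁p⇒x∈p x∉)
... | inj₁ x∈⁅y⁆ = inj₁ (x∈⁅y⁆⇒x≡y y x∈⁅y⁆)
... | inj₂ x∈⁅z⁆ = inj₂ (x∈⁅y⁆⇒x≡y z x∈⁅z⁆)

∈-tabulate : ∀ {f : Fin n → Bool} {x} → x ∈ tabulate f ⇔ f x ≡ true
∈-tabulate {f = f} {x} = mk⇔
  (λ x∈ → trans (sym (lookup∘tabulate f x)) ([]=⇒lookup x∈))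
  (λ fx → lookup⇒[]= x (tabulate f) (trans (lookup∘tabulate f x) fx))

preimage : ∀ {m} → (Fin m → Fin n) → Subset n → Subset m
preimage f p = tabulate (λ x → lookup p (f x))

∈-preimage : ∀ {m} {f : Fin m → Fin n} {x} → x ∈ preimage f p ⇔ f x ∈ p
∈-preimage {p = p} {f = f} {x} = mk⇔
  (λ x∈ → lookup⇒[]= (f x) p (Equivalence.to ∈-tabulate x∈))
  (λ fx∈ → Equivalence.from ∈-tabulate ([]=⇒lookup fx∈))

image : ∀ {k} → (Fin k → Fin n) → Subset n
image f = tabulate (λ y → does (any? λ i → f i ≟ y))

∈-image⁺ : ∀ {k} (f : Fin k → Fin n) i → f i ∈ image f
∈-image⁺ f i = Equivalence.from ∈-tabulate (dec-true (any? λ j → f j ≟ f i) (i , refl))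

∈-image⁻ : ∀ {k} (f : Fin k → Fin n) {y} → y ∈ image f → ∃ λ i → f i ≡ y
∈-image⁻ f {y} y∈ with any? (λ i → f i ≟ y) | Equivalence.to ∈-tabulate y∈
... | yes found | _ = found

∈-image-∷ : ∀ {k} (f : Fin k → Fin n) w {y} → y ∈ image f → y ∈ image (w Vector.∷ f)
∈-image-∷ f w y∈ with i , refl ← ∈-image⁻ f y∈ = ∈-image⁺ (w Vector.∷ f) (Fin.suc i)

-- Forts

module _ (G : Graph n) where

  adj⇒≢ : ∀ {v w} → adj G v w ≡ true → v ≢ w
  adj⇒≢ {v} v~w refl with () ← trans (sym (irref G v)) v~w

  neighbour∈∁⁅v⁆ : ∀ {v w} → adj G v w ≡ true → w ∈ ∁ ⁅ v ⁆
  neighbour∈∁⁅v⁆ v~w = x∉p⇒x∈∁p (x≢y⇒x∉⁅y⁆ (≢-sym (adj⇒≢ v~w)))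

  module _ {F : Subset n} {v : Fin n} where

    ∈∩N⁺ : ∀ {w} → w ∈ F → adj G v w ≡ true → w ∈ F ∩ N G v
    ∈∩N⁺ w∈F v~w = x∈p∩q⁺ (w∈F , Equivalence.from ∈-tabulate v~w)

    ∈∩N⁻ : ∀ {w} → w ∈ F ∩ N G v → w ∈ F × adj G v w ≡ true
    ∈∩N⁻ w∈ = let w∈F , w∈N = x∈p∩q⁻ F (N G v) w∈ in w∈F , Equivalence.to ∈-tabulate w∈N

    unique-neighbour⇒∣∩N∣≡1 : ∀ {w} → w ∈ F → adj G v w ≡ true →
      (∀ {u} → u ∈ F → adj G v u ≡ true → u ≡ w) → ∣ F ∩ N G v ∣ ≡ 1
    unique-neighbour⇒∣∩N∣≡1 w∈F v~w unique = Equivalence.from ∣p∣≡1⇔unique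
      (_ , ∈∩N⁺ w∈F v~w , λ u∈ → uncurry unique (∈∩N⁻ u∈))

    ∣∩N∣≡1⇒unique-neighbour : ∣ F ∩ N G v ∣ ≡ 1 →
      ∃ λ w → w ∈ F × adj G v w ≡ true × (∀ {u} → u ∈ F → adj G v u ≡ true → u ≡ w)
    ∣∩N∣≡1⇒unique-neighbour ∣∩N∣≡1 with w , w∈ , unique ← Equivalence.to ∣p∣≡1⇔unique ∣∩N∣≡1 =
      w , proj₁ (∈∩N⁻ w∈) , proj₂ (∈∩N⁻ w∈) , λ u∈F v~u → unique (∈∩N⁺ u∈F v~u)

    no-neighbour⇒∣∩N∣≢1 : (∀ {w} → w ∈ F → adj G v w ≢ true) → ∣ F ∩ N G v ∣ ≢ 1
    no-neighbour⇒∣∩N∣≢1 none ∣∩N∣≡1 = let _ , w∈F , v~w , _ = ∣∩N∣≡1⇒unique-neighbour ∣∩N∣≡1 in none w∈F v~w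

    two-neighbours⇒∣∩N∣≢1 : ∀ {w₁ w₂} → w₁ ≢ w₂ → w₁ ∈ F → adj G v w₁ ≡ true →
      w₂ ∈ F → adj G v w₂ ≡ true → ∣ F ∩ N G v ∣ ≢ 1
    two-neighbours⇒∣∩N∣≢1 w₁≢w₂ w₁∈F v~w₁ w₂∈F v~w₂ ∣∩N∣≡1 =
      let _ , _ , _ , unique = ∣∩N∣≡1⇒unique-neighbour ∣∩N∣≡1 in
      w₁≢w₂ (trans (unique w₁∈F v~w₁) (sym (unique w₂∈F v~w₂)))

  unique-neighbour⇒∣N∣≡1 : ∀ {v w} → adj G v w ≡ true → (∀ {u} → adj G v u ≡ true → u ≡ w) → ∣ N G v ∣ ≡ 1
  unique-neighbour⇒∣N∣≡1 {v} v~w unique =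
    trans (sym (cong ∣_∣ (∩-identityˡ (N G v)))) (unique-neighbour⇒∣∩N∣≡1 ∈⊤ v~w λ _ → unique)

  ∣N∣≡1⇒unique-neighbour : ∀ {v} → ∣ N G v ∣ ≡ 1 →
    ∃ λ w → adj G v w ≡ true × (∀ {u} → adj G v u ≡ true → u ≡ w)
  ∣N∣≡1⇒unique-neighbour {v} ∣N∣≡1
    with w , _ , v~w , unique ← ∣∩N∣≡1⇒unique-neighbour (trans (cong ∣_∣ (∩-identityˡ (N G v))) ∣N∣≡1)
    = w , v~w , unique ∈⊤

  ⊤-isFort : Fin n → IsFort G ⊤
  ⊤-isFort x = (x , ∈⊤) , λ _ v∉⊤ → contradiction ∈⊤ v∉⊤

  ∁⁅v⁆-isFort : ∀ {u v} → ∣ N G v ∣ ≢ 1 → u ≢ v → IsFort G (∁ ⁅ v ⁆)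
  ∁⁅v⁆-isFort {u} {v} ∣Nv∣≢1 u≢v = (u , x∉p⇒x∈∁p (x≢y⇒x∉⁅y⁆ u≢v)) , only-v-outside
    where
    only-v-outside : ∀ w → w ∉ ∁ ⁅ v ⁆ → ∣ ∁ ⁅ v ⁆ ∩ N G w ∣ ≢ 1
    only-v-outside w w∉ ∣∩N∣≡1 with refl ← x∈⁅y⁆⇒x≡y v (x∉∁p⇒x∈p w∉)
      with z , _ , v~z , unique ← ∣∩N∣≡1⇒unique-neighbour ∣∩N∣≡1
      = ∣Nv∣≢1 (unique-neighbour⇒∣N∣≡1 v~z λ v~u → unique (neighbour∈∁⁅v⁆ v~u) v~u)

  ∁⁅w⁆∪⁅c⁆-isFort : ∀ {w c p q} → (∀ {u} → adj G w u ≡ true → u ≡ c) →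
    p ≢ q → p ≢ w → q ≢ w → adj G c p ≡ true → adj G c q ≡ true → IsFort G (∁ (⁅ w ⁆ ∪ ⁅ c ⁆))
  ∁⁅w⁆∪⁅c⁆-isFort {w} {c} {p} {q} only-c p≢q p≢w q≢w c~p c~q = (p , p∈F) , w-c-outside
    where
    F = ∁ (⁅ w ⁆ ∪ ⁅ c ⁆)
    p∈F = x∈∁⁅y⁆∪⁅z⁆ p≢w (≢-sym (adj⇒≢ c~p))
    q∈F = x∈∁⁅y⁆∪⁅z⁆ q≢w (≢-sym (adj⇒≢ c~q))
    w-c-outside : ∀ v → v ∉ F → ∣ F ∩ N G v ∣ ≢ 1
    w-c-outside v v∉F with x∉∁⁅y⁆∪⁅z⁆ v∉F
    ... | inj₁ refl = no-neighbour⇒∣∩N∣≢1 {F = F} λ u∈F w~u →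
            x∈∁p⇒x∉p u∈F (x∈p∪q⁺ (inj₂ (subst (_∈ ⁅ c ⁆) (sym (only-c w~u)) (x∈⁅x⁆ c))))
    ... | inj₂ refl = two-neighbours⇒∣∩N∣≢1 p≢q p∈F c~p q∈F c~q

  Closed : Subset n → Set
  Closed L = ∀ {u w} → u ∈ L → adj G u w ≡ true → w ∈ L

  closed-isFort : ∀ {L x} → Closed L → x ∈ L → IsFort G L
  closed-isFort closed x∈L = (_ , x∈L) , λ v v∉L →
    no-neighbour⇒∣∩N∣≢1 λ {w} w∈L v~w → v∉L (closed w∈L (trans (adj-sym G w v) v~w))

  closed-∁-isFort : ∀ {L y} → Closed L → y ∉ L → IsFort G (∁ L)
  closed-∁-isFort closed y∉L = (_ , x∉p⇒x∈∁p y∉L) , λ v v∉∁L →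
    no-neighbour⇒∣∩N∣≢1 λ w∈∁L v~w → x∈∁p⇒x∉p w∈∁L (closed (x∉∁p⇒x∈p v∉∁L) v~w)

  isolated-edge-closed : ∀ {v w} → (∀ {t} → adj G v t ≡ true → t ≡ w) → (∀ {t} → adj G w t ≡ true → t ≡ v) →
    Closed (⁅ v ⁆ ∪ ⁅ w ⁆)
  isolated-edge-closed {v} {w} only-w only-v u∈ u~t with x∈p∪q⁻ ⁅ v ⁆ ⁅ w ⁆ u∈
  ... | inj₁ u∈⁅v⁆ with refl ← x∈⁅y⁆⇒x≡y v u∈⁅v⁆ = x∈p∪q⁺ (inj₂ (subst (_∈ ⁅ w ⁆) (sym (only-w u~t)) (x∈⁅x⁆ w)))
  ... | inj₂ u∈⁅w⁆ with refl ← x∈⁅y⁆⇒x≡y w u∈⁅w⁆ = x∈p∪q⁺ (inj₁ (subst (_∈ ⁅ v ⁆) (sym (only-v u~t)) (x∈⁅x⁆ v)))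

-- Separation and ZIr-sets

Separates : Graph n → Fin n → Fin n → Set
Separates G x y = ∃ λ F → IsFort G F × x ∈ F × y ∉ F

Inseparable : Graph n → Fin n → Set
Inseparable G x = ∀ {y} → Separates G x y → ¬ Separates G y x

module _ (G : Graph n) where

  ∁⁅y⁆-separates : ∀ {x y} → ∣ N G y ∣ ≢ 1 → x ≢ y → Separates G x y
  ∁⁅y⁆-separates {x} {y} ∣Ny∣≢1 x≢y =
    _ , ∁⁅v⁆-isFort G ∣Ny∣≢1 x≢y , x∉p⇒x∈∁p (x≢y⇒x∉⁅y⁆ x≢y) , x∈p⇒x∉∁p (x∈⁅x⁆ y)

  closed⇒separates : ∀ {L x y} → Closed G L → x ∈ L → y ∉ L → Separates G x y × Separates G y x
  closed⇒separates closed x∈L y∉L =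
    (_ , closed-isFort G closed x∈L , x∈L , y∉L) ,
    (_ , closed-∁-isFort G closed y∉L , x∉p⇒x∈∁p y∉L , x∈p⇒x∉∁p x∈L)

  ⁅x⁆-isZIrSet : ∀ x → IsZIrSet G ⁅ x ⁆
  ⁅x⁆-isZIrSet x y y∈⁅x⁆ with refl ← x∈⁅y⁆⇒x≡y x y∈⁅x⁆ = ⊤ , ⊤-isFort G y , ∩-identityʳ ⁅ y ⁆

  privateFort⇒separates : ∀ {T x y F} → IsPrivateFort G T x F → y ∈ T → y ≢ x → Separates G x y
  privateFort⇒separates {T} {x} {y} {F} (fort , T∩F≡⁅x⁆) y∈T y≢x = F , fort , x∈F , y∉F
    where
    x∈F : x ∈ F
    x∈F = proj₂ (x∈p∩q⁻ T F (subst (x ∈_) (sym T∩F≡⁅x⁆) (x∈⁅x⁆ x)))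
    y∉F : y ∉ F
    y∉F y∈F = y≢x (x∈⁅y⁆⇒x≡y x (subst (y ∈_) T∩F≡⁅x⁆ (x∈p∩q⁺ (y∈T , y∈F))))

  separates⇒privateFort : ∀ {x y} → ((F , _) : Separates G x y) → IsPrivateFort G (⁅ x ⁆ ∪ ⁅ y ⁆) x F
  separates⇒privateFort {x} {y} (F , fort , x∈F , y∉F) = fort , Equivalence.from p≡⁅x⁆⇔unique
    (x∈p∩q⁺ (x∈p∪q⁺ (inj₁ (x∈⁅x⁆ x)) , x∈F) , only-x)
    where
    only-x : ∀ {z} → z ∈ (⁅ x ⁆ ∪ ⁅ y ⁆) ∩ F → z ≡ x
    only-x z∈ with z∈⁅x⁆∪⁅y⁆ , z∈F ← x∈p∩q⁻ _ F z∈ | x∈p∪q⁻ ⁅ x ⁆ ⁅ y ⁆ z∈⁅x⁆∪⁅y⁆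
    ... | inj₁ z∈⁅x⁆ = x∈⁅y⁆⇒x≡y x z∈⁅x⁆
    ... | inj₂ z∈⁅y⁆ with refl ← x∈⁅y⁆⇒x≡y y z∈⁅y⁆ = contradiction z∈F y∉F

  ⁅x⁆∪⁅y⁆-isZIrSet : ∀ {x y} → Separates G x y → Separates G y x → IsZIrSet G (⁅ x ⁆ ∪ ⁅ y ⁆)
  ⁅x⁆∪⁅y⁆-isZIrSet {x} {y} x∖y y∖x z z∈ with x∈p∪q⁻ ⁅ x ⁆ ⁅ y ⁆ z∈
  ... | inj₁ z∈⁅x⁆ with refl ← x∈⁅y⁆⇒x≡y x z∈⁅x⁆ = _ , separates⇒privateFort x∖y
  ... | inj₂ z∈⁅y⁆ with refl ← x∈⁅y⁆⇒x≡y y z∈⁅y⁆ =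
    _ , subst (λ T → IsPrivateFort G T y _) (∪-comm ⁅ y ⁆ ⁅ x ⁆) (separates⇒privateFort y∖x)

  inseparable⇒⁅x⁆-isMaximal : ∀ {x} → Inseparable G x → IsMaximalZIrSet G ⁅ x ⁆
  inseparable⇒⁅x⁆-isMaximal {x} inseparable = ⁅x⁆-isZIrSet x , ⊆⁅x⁆
    where
    ⊆⁅x⁆ : ∀ T → ⁅ x ⁆ ⊆ T → IsZIrSet G T → T ⊆ ⁅ x ⁆
    ⊆⁅x⁆ T ⁅x⁆⊆T T-isZIr {y} y∈T with y ≟ x
    ... | yes refl = x∈⁅x⁆ x
    ... | no y≢x = contradiction
      (privateFort⇒separates (proj₂ (T-isZIr y y∈T)) x∈T (≢-sym y≢x))
      (inseparable (privateFort⇒separates (proj₂ (T-isZIr x x∈T)) y∈T y≢x))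
      where x∈T = ⁅x⁆⊆T (x∈⁅x⁆ x)

  ⁅x⁆-isMaximal⇒inseparable : ∀ {x} → IsMaximalZIrSet G ⁅ x ⁆ → Inseparable G x
  ⁅x⁆-isMaximal⇒inseparable {x} (_ , maximal) {y} x∖y@(_ , _ , x∈F , y∉F) y∖x
    with refl ← x∈⁅y⁆⇒x≡y x (maximal _ (p⊆p∪q ⁅ y ⁆) (⁅x⁆∪⁅y⁆-isZIrSet x∖y y∖x) (x∈p∪q⁺ (inj₂ (x∈⁅x⁆ y))))
    = y∉F x∈F

  isMaximal⇒1≤∣S∣ : ∀ {S} → Fin n → IsMaximalZIrSet G S → 1 ≤ ∣ S ∣
  isMaximal⇒1≤∣S∣ {S} x (_ , maximal) with ∣ S ∣ in ∣S∣≡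
  ... | suc _ = s≤s z≤n
  ... | zero with refl ← ∣p∣≡0⇒p≡⊥ {p = S} ∣S∣≡ =
    contradiction (maximal ⁅ x ⁆ ⊥⊆ (⁅x⁆-isZIrSet x) (x∈⁅x⁆ x)) ∉⊥

zir≡1⇔inseparable : ∀ {m} (G : Graph (suc m)) → ZirEq G 1 ⇔ ∃ (Inseparable G)
zir≡1⇔inseparable G = mk⇔
  (λ ((S , S-isMaximal , ∣S∣≡1) , _) → let x , S≡⁅x⁆ = ∣p∣≡1⇒p≡⁅x⁆ ∣S∣≡1 in
    x , ⁅x⁆-isMaximal⇒inseparable G (subst (IsMaximalZIrSet G) S≡⁅x⁆ S-isMaximal))
  (λ (x , inseparable) →
    (⁅ x ⁆ , inseparable⇒⁅x⁆-isMaximal G inseparable , ∣⁅x⁆∣≡1 x) , λ _ → isMaximal⇒1≤∣S∣ G Fin.zero)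

-- Isomorphisms

module _ {G H : Graph n} (G≅H : G ≅ H) where

  private
    open Inverse (proj₁ G≅H)

    adj-from : ∀ u w → adj G (from u) (from w) ≡ adj H u w
    adj-from u w = trans (proj₂ G≅H (from u) (from w)) (cong₂ (adj H) (strictlyInverseˡ u) (strictlyInverseˡ w))

    to∈preimage : ∀ {F u} → u ∈ F → to u ∈ preimage from F
    to∈preimage {F} {u} u∈F = Equivalence.from ∈-preimage (subst (_∈ F) (sym (strictlyInverseʳ u)) u∈F)

  ≅-sym : H ≅ G
  ≅-sym = ↔-sym (proj₁ G≅H) , λ u w → sym (adj-from u w)

  ≅-preserves-fort : ∀ {F} → IsFort G F → IsFort H (preimage from F)
  ≅-preserves-fort {F} ((u , u∈F) , outside-G) = (to u , to∈preimage u∈F) , outside-H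
    where
    adj-to : ∀ v u → adj H v (to u) ≡ adj G (from v) u
    adj-to v u = trans (sym (adj-from v (to u))) (cong (adj G (from v)) (strictlyInverseʳ u))
    outside-H : ∀ v → v ∉ preimage from F → ∣ preimage from F ∩ N H v ∣ ≢ 1
    outside-H v v∉ ∣∩N∣≡1 with w , w∈ , v~w , unique ← ∣∩N∣≡1⇒unique-neighbour H {F = preimage from F} ∣∩N∣≡1 =
      outside-G (from v) (v∉ ∘ Equivalence.from ∈-preimage)
        (unique-neighbour⇒∣∩N∣≡1 G {F = F} (Equivalence.to ∈-preimage w∈) (trans (adj-from v w) v~w)
          λ {u} u∈F fv~u → trans (sym (strictlyInverseʳ u)) (cong from (unique (to∈preimage u∈F) (trans (adj-to v u) fv~u))))

  ≅-preserves-separates : ∀ {x y} → Separates G x y → Separates H (to x) (to y)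
  ≅-preserves-separates {x} {y} (F , fort , x∈F , y∉F) =
    preimage from F , ≅-preserves-fort fort , to∈preimage x∈F ,
    λ y∈ → y∉F (subst (_∈ F) (strictlyInverseʳ y) (Equivalence.to ∈-preimage y∈))

  ≅-reflects-inseparable : ∀ {y} → Inseparable H y → Inseparable G (from y)
  ≅-reflects-inseparable {y} inseparable fy∖z z∖fy = inseparable
    (subst (λ t → Separates H t _) (strictlyInverseˡ y) (≅-preserves-separates fy∖z))
    (subst (Separates H _) (strictlyInverseˡ y) (≅-preserves-separates z∖fy))

-- Paths and stars

isOne[a-b]⇒ : ∀ a b → isOne ((a ∸ b) + (b ∸ a)) ≡ true → suc a ≡ b ⊎ suc b ≡ a
isOne[a-b]⇒ zero (suc zero) _ = inj₁ refl
isOne[a-b]⇒ (suc zero) zero _ = inj₂ refl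
isOne[a-b]⇒ (suc a) (suc b) e = Sum.map (cong suc) (cong suc) (isOne[a-b]⇒ a b e)

isOne[a-1+a] : ∀ a → isOne ((a ∸ suc a) + (suc a ∸ a)) ≡ true
isOne[a-1+a] zero = refl
isOne[a-1+a] (suc a) = isOne[a-1+a] a

pathAdj≡true⇒ : ∀ {i j : Fin n} → pathAdj i j ≡ true → suc (toℕ i) ≡ toℕ j ⊎ suc (toℕ j) ≡ toℕ i
pathAdj≡true⇒ {i = i} {j} = isOne[a-b]⇒ (toℕ i) (toℕ j)

pathAdj-inject₁-suc : ∀ (i : Fin n) → pathAdj (inject₁ i) (Fin.suc i) ≡ true
pathAdj-inject₁-suc i = subst (λ a → isOne ((a ∸ suc (toℕ i)) + (suc (toℕ i) ∸ a)) ≡ true)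
  (sym (toℕ-inject₁ i)) (isOne[a-1+a] (toℕ i))

P-fort∋zero : ∀ {m F} → IsFort (P (suc m)) F → Fin.zero ∈ F
P-fort∋zero {m} {F} ((u , u∈F) , ∣∩N∣≢1) =
  decidable-stable (Fin.zero ∈? F) λ 0∉F → below-∉ 0∉F (toℕ u) ℕ.≤-refl u∈F
  where
  below-∉ : Fin.zero ∉ F → ∀ k {j : Fin (suc m)} → toℕ j ≤ k → j ∉ F
  below-∉ 0∉F _ {Fin.zero} _ = 0∉F
  below-∉ 0∉F (suc k) {Fin.suc i} (s≤s i≤k) 1+i∈F =
    ∣∩N∣≢1 (inject₁ i) (below-∉ 0∉F k (subst (_≤ k) (sym (toℕ-inject₁ i)) i≤k))
      (unique-neighbour⇒∣∩N∣≡1 (P _) 1+i∈F (pathAdj-inject₁-suc i) only-suc)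
    where
    only-suc : ∀ {v} → v ∈ F → pathAdj (inject₁ i) v ≡ true → v ≡ Fin.suc i
    only-suc {v} v∈F i~v with pathAdj≡true⇒ i~v
    ... | inj₁ 1+i≡v = toℕ-injective (trans (sym 1+i≡v) (cong suc (toℕ-inject₁ i)))
    ... | inj₂ 1+v≡i = contradiction v∈F (below-∉ 0∉F k
        (ℕ.≤-trans (ℕ.n≤1+n (toℕ v)) (subst (_≤ k) (sym (trans 1+v≡i (toℕ-inject₁ i))) i≤k)))

P-inseparable : ∀ {m} → Inseparable (P (suc m)) Fin.zero
P-inseparable _ (_ , fort , _ , 0∉F) = 0∉F (P-fort∋zero fort)

Star-fort∋zero⇒full : ∀ {m F} → IsFort (Star (suc m)) F → Fin.zero ∈ F → ∀ y → y ∈ F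
Star-fort∋zero⇒full _ 0∈F Fin.zero = 0∈F
Star-fort∋zero⇒full {F = F} (_ , ∣∩N∣≢1) 0∈F (Fin.suc i) = decidable-stable (Fin.suc i ∈? F) λ leaf∉F →
  ∣∩N∣≢1 (Fin.suc i) leaf∉F (unique-neighbour⇒∣∩N∣≡1 (Star _) {v = Fin.suc i} 0∈F refl only-centre)
  where
  only-centre : ∀ {v} → v ∈ F → starAdj (Fin.suc i) v ≡ true → v ≡ Fin.zero
  only-centre {Fin.zero} _ _ = refl

Star-inseparable : ∀ {m} → Inseparable (Star (suc m)) Fin.zero
Star-inseparable (_ , fort , 0∈F , y∉F) _ = y∉F (Star-fort∋zero⇒full fort 0∈F _)

Star≅-centred-at : ∀ {m} (G : Graph (suc m)) x → (∀ {v} → v ≢ x → adj G v x ≡ true) →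
  (∀ {v w} → v ≢ x → w ≢ x → adj G v w ≢ true) → Star (suc m) ≅ G
Star≅-centred-at G x adj-x not-adj = σ , starAdj≡adj
  where
  σ = transpose Fin.zero x
  open Inverse σ
  -- to Fin.zero reduces to x.
  leaf≢x : ∀ i → to (Fin.suc i) ≢ x
  leaf≢x i σi≡x
    with () ← trans (sym (strictlyInverseʳ (Fin.suc i))) (trans (cong from σi≡x) (strictlyInverseʳ Fin.zero))
  starAdj≡adj : ∀ i j → starAdj i j ≡ adj G (to i) (to j)
  starAdj≡adj Fin.zero Fin.zero = sym (irref G x)
  starAdj≡adj Fin.zero (Fin.suc j) = sym (trans (adj-sym G x _) (adj-x (leaf≢x j)))
  starAdj≡adj (Fin.suc i) Fin.zero = sym (adj-x (leaf≢x i))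
  starAdj≡adj (Fin.suc i) (Fin.suc j) = sym (¬-not (not-adj (leaf≢x i) (leaf≢x j)))

-- The star case

module StarCase {m} (G : Graph (suc m)) {x} (inseparable : Inseparable G x) (∣Nx∣≢1 : ∣ N G x ∣ ≢ 1) where

  only-neighbour : ∀ {v} → v ≢ x → ∃ λ w → adj G v w ≡ true × (∀ {u} → adj G v u ≡ true → u ≡ w)
  only-neighbour {v} v≢x with ∣ N G v ∣ ℕ.≟ 1
  ... | yes ∣Nv∣≡1 = ∣N∣≡1⇒unique-neighbour G ∣Nv∣≡1
  ... | no ∣Nv∣≢1 = ⊥-elim (inseparable (∁⁅y⁆-separates G ∣Nv∣≢1 (≢-sym v≢x)) (∁⁅y⁆-separates G ∣Nx∣≢1 v≢x))

  neighbour≡x : ∀ {v w} → v ≢ x → adj G v w ≡ true → w ≡ x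
  neighbour≡x {v} {w} v≢x v~w with w ≟ x
  ... | yes w≡x = w≡x
  ... | no w≢x = ⊥-elim (let v∖x , x∖v = closed⇒separates G vw-closed (x∈p∪q⁺ (inj₁ (x∈⁅x⁆ v))) x∉vw in
                         inseparable x∖v v∖x)
    where
    only : ∀ {a b} → a ≢ x → adj G a b ≡ true → ∀ {t} → adj G a t ≡ true → t ≡ b
    only a≢x a~b a~t = let _ , _ , unique = only-neighbour a≢x in trans (unique a~t) (sym (unique a~b))
    vw-closed : Closed G (⁅ v ⁆ ∪ ⁅ w ⁆)
    vw-closed = isolated-edge-closed G (only v≢x v~w) (only w≢x (trans (adj-sym G w v) v~w))
    x∉vw : x ∉ ⁅ v ⁆ ∪ ⁅ w ⁆
    x∉vw = x∈∁p⇒x∉p (x∈∁⁅y⁆∪⁅z⁆ (≢-sym v≢x) (≢-sym w≢x))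

  Star≅G : Star (suc m) ≅ G
  Star≅G = Star≅-centred-at G x
    (λ v≢x → let _ , v~w , _ = only-neighbour v≢x in subst (λ t → adj G _ t ≡ true) (neighbour≡x v≢x v~w) v~w)
    (λ v≢x w≢x v~w → w≢x (neighbour≡x v≢x v~w))

-- The path case

-- The path is indexed from its growing end, so that x is the last vertex, extending the path is
-- consing a vertex, and pathAdj (suc i) (suc j) reduces to pathAdj i j.
record PendantPath (G : Graph n) (x : Fin n) (k : ℕ) : Set where
  field
    vertex : Fin (suc k) → Fin n
    vertex-injective : Injective _≡_ _≡_ vertex
    vertex-adj : ∀ i j → adj G (vertex i) (vertex j) ≡ pathAdj i j
    vertex-last : vertex (Fin.fromℕ k) ≡ x
    inner-closed : ∀ i {w} → adj G (vertex (Fin.suc i)) w ≡ true → w ∈ image vertex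

module _ {G : Graph n} {x : Fin n} where

  single-vertex : PendantPath G x 0
  single-vertex = record
    { vertex = λ _ → x
    ; vertex-injective = λ { {Fin.zero} {Fin.zero} _ → refl }
    ; vertex-adj = λ { Fin.zero Fin.zero → irref G x }
    ; vertex-last = refl
    ; inner-closed = λ ()
    }

  extend : ∀ {k} (p : PendantPath G x k) {w} → let open PendantPath p in
    w ∉ image vertex → adj G (vertex Fin.zero) w ≡ true →
    (∀ {u} → u ∉ image vertex → adj G (vertex Fin.zero) u ≡ true → u ≡ w) → PendantPath G x (suc k)
  extend p {w} w∉ end~w only-w = record
    { vertex = vertex′
    ; vertex-injective = injective
    ; vertex-adj = adjacency
    ; vertex-last = vertex-last
    ; inner-closed = closed
    }
    where
    open PendantPath p
    vertex′ = w Vector.∷ vertex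
    inner≁w : ∀ i → adj G (vertex (Fin.suc i)) w ≢ true
    inner≁w i v~w = w∉ (inner-closed i v~w)
    injective : Injective _≡_ _≡_ vertex′
    injective {Fin.zero} {Fin.zero} _ = refl
    injective {Fin.zero} {Fin.suc j} w≡ = contradiction (subst (_∈ image vertex) (sym w≡) (∈-image⁺ vertex j)) w∉
    injective {Fin.suc i} {Fin.zero} ≡w = contradiction (subst (_∈ image vertex) ≡w (∈-image⁺ vertex i)) w∉
    injective {Fin.suc i} {Fin.suc j} e = cong Fin.suc (vertex-injective e)
    adjacency : ∀ i j → adj G (vertex′ i) (vertex′ j) ≡ pathAdj i j
    adjacency Fin.zero Fin.zero = irref G w
    adjacency Fin.zero (Fin.suc Fin.zero) = trans (adj-sym G w _) end~w
    adjacency Fin.zero (Fin.suc (Fin.suc j)) = trans (adj-sym G w _) (¬-not (inner≁w j))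
    adjacency (Fin.suc Fin.zero) Fin.zero = end~w
    adjacency (Fin.suc (Fin.suc i)) Fin.zero = ¬-not (inner≁w i)
    adjacency (Fin.suc i) (Fin.suc j) = vertex-adj i j
    closed : ∀ i {u} → adj G (vertex′ (Fin.suc i)) u ≡ true → u ∈ image vertex′
    closed Fin.zero {u} end~u with u ∈? image vertex
    ... | yes u∈ = ∈-image-∷ vertex w u∈
    ... | no u∉ = subst (_∈ image vertex′) (sym (only-w u∉ end~u)) (∈-image⁺ vertex′ Fin.zero)
    closed (Fin.suc i) v~u = ∈-image-∷ vertex w (inner-closed i v~u)

module _ {G : Graph n} {x k} (p : PendantPath G x k) (covers : ∀ w → w ∈ image (PendantPath.vertex p)) where
  open PendantPath p

  vertex-↔ : Fin (suc k) ↔ Fin n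
  vertex-↔ = mk↔ₛ′ vertex index (λ w → proj₂ (∈-image⁻ vertex (covers w)))
    (λ i → vertex-injective (proj₂ (∈-image⁻ vertex (covers (vertex i)))))
    where
    index : Fin n → Fin (suc k)
    index w = proj₁ (∈-image⁻ vertex (covers w))

spanning-path⇒P≅ : ∀ {m} {G : Graph (suc m)} {x k} (p : PendantPath G x k) →
  (∀ w → w ∈ image (PendantPath.vertex p)) → k ≡ m → P (suc m) ≅ G
spanning-path⇒P≅ p covers refl = vertex-↔ p covers , λ i j → sym (PendantPath.vertex-adj p i j)

module PathCase {m} (G : Graph (suc m)) {x} (inseparable : Inseparable G x) (∣Nx∣≡1 : ∣ N G x ∣ ≡ 1) where

  module Exits {k} (p : PendantPath G x k) where
    open PendantPath p public

    L : Subset (suc m)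
    L = image vertex

    end : Fin (suc m)
    end = vertex Fin.zero

    exits : Subset (suc m)
    exits = ∁ L ∩ N G end

    x∈L : x ∈ L
    x∈L = subst (_∈ L) vertex-last (∈-image⁺ vertex (Fin.fromℕ k))

    no-exit⇒closed : Empty exits → Closed G L
    no-exit⇒closed no-exit {w = t} u∈L u~t with ∈-image⁻ vertex u∈L
    ... | Fin.suc i , refl = inner-closed i u~t
    ... | Fin.zero , refl = decidable-stable (t ∈? L) λ t∉L → no-exit (t , ∈∩N⁺ G (x∉p⇒x∈∁p t∉L) u~t)

    ∁L-isFort : ∣ exits ∣ ≢ 1 → Nonempty exits → IsFort G (∁ L)
    ∁L-isFort ∣exits∣≢1 (w , w∈) = (w , proj₁ (∈∩N⁻ G w∈)) , λ v v∉∁L →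
      case ∈-image⁻ vertex (x∉∁p⇒x∈p v∉∁L) of λ where
        (Fin.zero , refl) → ∣exits∣≢1
        (Fin.suc i , refl) → no-neighbour⇒∣∩N∣≢1 G λ t∈∁L v~t → x∈∁p⇒x∉p t∈∁L (inner-closed i v~t)

  open Exits

  ∣exits∣≢1⇒no-exit : ∀ {k} (p : PendantPath G x k) → ∣ exits p ∣ ≢ 1 → Empty (exits p)
  ∣exits∣≢1⇒no-exit {zero} p ∣exits∣≢1 (w₁ , w₁∈)
    with w₂ , w₂∈ , w₂≢w₁ ← ∣p∣≢1⇒another ∣exits∣≢1 w₁∈
    with _ , _ , only-z ← ∣N∣≡1⇒unique-neighbour G ∣Nx∣≡1
    = w₂≢w₁ (trans (only-z (x~ w₂∈)) (sym (only-z (x~ w₁∈))))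
    where
    x~ : ∀ {w} → w ∈ exits p → adj G x w ≡ true
    x~ w∈ = subst (λ v → adj G v _ ≡ true) (vertex-last p) (proj₂ (∈∩N⁻ G w∈))
  ∣exits∣≢1⇒no-exit {suc k} p ∣exits∣≢1 (w₁ , w₁∈) = inseparable x∖w₁ w₁∖x
    where
    w₁∈∁L = proj₁ (∈∩N⁻ G w₁∈)
    end~w₁ = proj₂ (∈∩N⁻ G w₁∈)

    on≢off : ∀ {v w} → v ∈ L p → w ∈ ∁ (L p) → v ≢ w
    on≢off v∈L w∈∁L refl = x∈∁p⇒x∉p w∈∁L v∈L

    x≢w₁ : x ≢ w₁
    x≢w₁ = on≢off (x∈L p) w₁∈∁L

    x≢end : x ≢ end p
    x≢end x≡end with () ← vertex-injective p (trans (vertex-last p) x≡end)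

    w₁∖x : Separates G w₁ x
    w₁∖x = ∁ (L p) , ∁L-isFort p ∣exits∣≢1 (w₁ , w₁∈) , w₁∈∁L , x∈p⇒x∉∁p (x∈L p)

    x∖w₁ : Separates G x w₁
    x∖w₁ with ∣ N G w₁ ∣ ℕ.≟ 1
    ... | no ∣Nw₁∣≢1 = ∁⁅y⁆-separates G ∣Nw₁∣≢1 x≢w₁
    ... | yes ∣Nw₁∣≡1
      with w₂ , w₂∈ , w₂≢w₁ ← ∣p∣≢1⇒another ∣exits∣≢1 w₁∈
      with _ , _ , only-z ← ∣N∣≡1⇒unique-neighbour G ∣Nw₁∣≡1
      = ∁ (⁅ w₁ ⁆ ∪ ⁅ end p ⁆) , fort , x∈∁⁅y⁆∪⁅z⁆ x≢w₁ x≢end , x∈p⇒x∉∁p (x∈p∪q⁺ (inj₁ (x∈⁅x⁆ w₁)))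
      where
      v₁ = Fin.suc Fin.zero
      v₁∈L = ∈-image⁺ (vertex p) v₁
      only-end : ∀ {u} → adj G w₁ u ≡ true → u ≡ end p
      only-end w₁~u = trans (only-z w₁~u) (sym (only-z (trans (adj-sym G w₁ (end p)) end~w₁)))
      fort : IsFort G (∁ (⁅ w₁ ⁆ ∪ ⁅ end p ⁆))
      fort = ∁⁅w⁆∪⁅c⁆-isFort G only-end (on≢off v₁∈L (proj₁ (∈∩N⁻ G w₂∈))) (on≢off v₁∈L w₁∈∁L) w₂≢w₁
        (vertex-adj p Fin.zero v₁) (proj₂ (∈∩N⁻ G w₂∈))

  grow : ∀ {k} (p : PendantPath G x k) → PendantPath G x (suc k) ⊎ (∀ w → w ∈ L p)
  grow p with ∣ exits p ∣ ℕ.≟ 1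
  ... | yes ∣exits∣≡1 with w , w∈∁L , end~w , unique ← ∣∩N∣≡1⇒unique-neighbour G ∣exits∣≡1 =
    inj₁ (extend p (x∈∁p⇒x∉p w∈∁L) end~w λ u∉L end~u → unique (x∉p⇒x∈∁p u∉L) end~u)
  ... | no ∣exits∣≢1 with nonempty? (∁ (L p))
  ...   | yes (y , y∈∁L) = ⊥-elim (uncurry inseparable
          (closed⇒separates G (no-exit⇒closed p (∣exits∣≢1⇒no-exit p ∣exits∣≢1)) (x∈L p) (x∈∁p⇒x∉p y∈∁L)))
  ...   | no ∁L-empty = inj₂ λ w → x∉∁p⇒x∈p λ w∈∁L → ∁L-empty (w , w∈∁L)

  grow-until-≅ : ∀ d {k} → d + k ≡ m → PendantPath G x k → P (suc m) ≅ G
  grow-until-≅ d e p with grow p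
  ... | inj₂ covers = spanning-path⇒P≅ p covers (ℕ.suc-injective (↔⇒≡ (vertex-↔ p covers)))
  grow-until-≅ zero refl p | inj₁ longer = ⊥-elim (ℕ.1+n≰n (injective⇒≤ (vertex-injective longer)))
  grow-until-≅ (suc d) e p | inj₁ longer = grow-until-≅ d (trans (ℕ.+-suc d _) e) longer

  P≅G : P (suc m) ≅ G
  P≅G = grow-until-≅ m (ℕ.+-identityʳ m) single-vertex

inseparable⇒≅P⊎≅Star : ∀ {m} (G : Graph (suc m)) {x} → Inseparable G x → G ≅ P (suc m) ⊎ G ≅ Star (suc m)
inseparable⇒≅P⊎≅Star G {x} inseparable with ∣ N G x ∣ ℕ.≟ 1
... | yes ∣Nx∣≡1 = inj₁ (≅-sym {G = P _} {H = G} (PathCase.P≅G G inseparable ∣Nx∣≡1))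
... | no ∣Nx∣≢1 = inj₂ (≅-sym {G = Star _} {H = G} (StarCase.Star≅G G inseparable ∣Nx∣≢1))

theorem5p9 : (m : ℕ) → (G : Graph (suc m)) →
    ZirEq G 1 ⇔ (G ≅ P (suc m) ⊎ G ≅ Star (suc m))
theorem5p9 m G = mk⇔
  (λ zir≡1 → inseparable⇒≅P⊎≅Star G (proj₂ (to zir≡1)))
  (λ where
    (inj₁ G≅P) → from (_ , ≅-reflects-inseparable {G = G} {H = P (suc m)} G≅P P-inseparable)
    (inj₂ G≅Star) → from (_ , ≅-reflects-inseparable {G = G} {H = Star (suc m)} G≅Star Star-inseparable))
  where open Equivalence (zir≡1⇔inseparable G)
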